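{- Let $n, k$ be positive integers. If the box $B(n^k) = B(n,\ldots,n)$ ($k$ entries) is good, then $\alpha(\bar C_{2n+1}^{\boxtimes k}) \geq 2^k + 1$.
   Context: For positive integers $m$, $[m]=\{1,\ldots,m\}$. For positive integers $n_1,\ldots,n_k$, the box is $B(n_1,\ldots,n_k) = [2n_1]\times\cdots\times[2n_k]$, and $\partial B(n_1,\ldots,n_k)$ is the set of $x \in B(n_1,\ldots,n_k)$ with $x_i \in \{1, 2n_i\}$ for some $i \in [k]$. For $x,y$ in the box, write $x \sim y$ if $x=y$ or $|x_i-y_i|=1$ for some $i\in[k]$. The box is good if there is a subset $S \subseteq \partial B(n_1,\ldots,n_k)$ (a skeleton) with $|S| = 2^k$ and $x\sim y$ for all $x,y\in S$. $\bar C_{2n+1}$ is the complement of the $(2n+1)$-cycle, $\alpha$ is the independence number, and $\boxtimes$ denotes the strong product. -}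

module Defs where

open import Data.Nat using (ℕ; zero; suc; _+_; _*_; _^_; _≤_; _%_)
open import Data.Fin using (Fin; toℕ)
open import Data.Vec using (Vec; lookup)
open import Data.List using (List; length)
open import Data.List.Membership.Propositional using (_∈_)
open import Data.List.Relation.Unary.Unique.Propositional using (Unique)
open import Data.List.Relation.Unary.All using (All)
open import Data.Product using (Σ; ∃; _×_)
open import Data.Sum using (_⊎_)
open import Relation.Nullary using (¬_)
open import Relation.Binary.PropositionalEquality using (_≡_; _≢_)

-- Boxes.  A point of Z^k is a vector of naturals of length k.

Point : ℕ → Set
Point k = Vec ℕ k

InBox : (n : ℕ) {k : ℕ} → Point k → Set
InBox n {k} x = (i : Fin k) → (1 ≤ lookup x i) × (lookup x i ≤ 2 * n)

InBoundary : (n : ℕ) {k : ℕ} → Point k → Set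
InBoundary n {k} x =
  InBox n x × ∃ λ (i : Fin k) → (lookup x i ≡ 1) ⊎ (lookup x i ≡ 2 * n)

_∼_ : {k : ℕ} → Point k → Point k → Set
_∼_ {k} x y = (x ≡ y) ⊎ (∃ λ (i : Fin k) →
                 (lookup x i ≡ suc (lookup y i)) ⊎ (lookup y i ≡ suc (lookup x i)))

IsSkeleton : (n k : ℕ) → List (Point k) → Set
IsSkeleton n k S =
  Unique S × (length S ≡ 2 ^ k) × All (InBoundary n) S ×
  ((x y : Point k) → x ∈ S → y ∈ S → x ∼ y)

GoodCube : (n k : ℕ) → Set
GoodCube n k = ∃ λ (S : List (Point k)) → IsSkeleton n k S

record Graph : Set₁ where
  field
    V   : Set
    Adj : V → V → Set
open Graph public

cycleAdj : (m : ℕ) → Fin m → Fin m → Set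
cycleAdj zero () b
cycleAdj (suc m) a b =
  (a ≢ b) × ((toℕ b ≡ (toℕ a + 1) % suc m) ⊎ (toℕ a ≡ (toℕ b + 1) % suc m))

Cycle : ℕ → Graph
Cycle m = record { V = Fin m ; Adj = cycleAdj m }

Complement : Graph → Graph
Complement G = record { V = V G ; Adj = λ a b → (a ≢ b) × ¬ Adj G a b }

StrongPower : Graph → ℕ → Graph
StrongPower G k = record
  { V   = Vec (V G) k
  ; Adj = λ x y → (x ≢ y) ×
          ((i : Fin k) → (lookup x i ≡ lookup y i) ⊎ Adj G (lookup x i) (lookup y i)) }

IsIndependent : (G : Graph) → List (V G) → Set
IsIndependent G S = Unique S × ((x y : V G) → x ∈ S → y ∈ S → ¬ Adj G x y)

IndependenceNumber≥ : Graph → ℕ → Set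
IndependenceNumber≥ G m = ∃ λ (S : List (V G)) → IsIndependent G S × (length S ≡ m)

{-# OPTIONS --safe #-}
module Submission where

-- Read the box [2n]^k inside the vertex set ℤ_{2n+1}^k of the strong power. Two skeleton
-- points differ by exactly 1 in some coordinate, so they are adjacent in C_{2n+1} there and
-- hence non-adjacent in the strong power of the complement. Every boundary point has a
-- coordinate equal to 1 or 2n, both neighbours of 0 in C_{2n+1}, so the origin (which is
-- outside the box) can be added to the image of a skeleton, giving 2^k + 1 independent vertices.

open import Defs
open import Data.Nat using (ℕ; suc; _+_; _*_; _^_; _≤_; _%_)
open import Data.Nat.Properties using (+-comm; 1+n≢n; 1+n≢0; <⇒≢; ≤-trans; m≤m+n)
open import Data.Nat.DivMod using (_mod_; m<n⇒m%n≡m; m≤n⇒m%n≡m; n%n≡0)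
open import Data.Fin using (Fin; toℕ; zero; fromℕ<)
open import Data.Fin.Properties using (toℕ<n; toℕ-fromℕ<)
open import Data.Vec as Vec using (Vec; lookup; replicate; tabulate)
open import Data.Vec.Properties using (lookup-map; lookup-replicate; tabulate∘lookup; tabulate-cong)
open import Data.List as List using (_∷_)
open import Data.List.Properties using (length-map)
open import Data.List.Membership.Propositional using (_∈_)
open import Data.List.Membership.Propositional.Properties using (∈-map⁻)
open import Data.List.Relation.Unary.All as All using (All)
open import Data.List.Relation.Unary.All.Properties as All using ()
open import Data.List.Relation.Unary.Any using (here; there)
open import Data.List.Relation.Unary.Unique.Propositional using (Unique)
open import Data.Product using (∃; _,_; proj₁; proj₂)
open import Data.Sum using (inj₁; inj₂)
open import Data.Empty using (⊥-elim)
open import Relation.Nullary using (¬_)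
open import Relation.Binary.PropositionalEquality

lookup-extensionality : ∀ {a} {A : Set a} {k} (xs ys : Vec A k) →
  (∀ i → lookup xs i ≡ lookup ys i) → xs ≡ ys
lookup-extensionality xs ys eq = begin
  xs                 ≡⟨ tabulate∘lookup xs ⟨
  tabulate (lookup xs) ≡⟨ tabulate-cong eq ⟩
  tabulate (lookup ys) ≡⟨ tabulate∘lookup ys ⟩
  ys                 ∎
  where open ≡-Reasoning

unique-map⁺-injectiveOn : ∀ {a b p} {A : Set a} {B : Set b} {P : A → Set p} {f : A → B} →
  (∀ {x y} → P x → P y → f x ≡ f y → x ≡ y) →
  ∀ {xs} → All P xs → Unique xs → Unique (List.map f xs)
unique-map⁺-injectiveOn inj All.[] _ = Unique.[]
unique-map⁺-injectiveOn inj (px All.∷ pxs) (x∉xs Unique.∷ u) =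
  All.map⁺ (All.zipWith (λ (x≢y , py) fx≡fy → x≢y (inj px py fx≡fy)) (x∉xs , pxs))
    Unique.∷ unique-map⁺-injectiveOn inj pxs u

¬strongComplementAdj : (G : Graph) {k : ℕ} (x y : Vec (V G) k) (i : Fin k) →
  lookup x i ≢ lookup y i → Adj G (lookup x i) (lookup y i) →
  ¬ Adj (StrongPower (Complement G) k) x y
¬strongComplementAdj G x y i xᵢ≢yᵢ xᵢ~yᵢ (_ , close) with close i
... | inj₁ xᵢ≡yᵢ       = xᵢ≢yᵢ xᵢ≡yᵢ
... | inj₂ (_ , xᵢ≁yᵢ) = xᵢ≁yᵢ xᵢ~yᵢ

cycleAdj-sym : ∀ {m} (a b : Fin m) → cycleAdj m a b → cycleAdj m b a
cycleAdj-sym {suc _} a b (a≢b , inj₁ e) = (λ b≡a → a≢b (sym b≡a)) , inj₂ e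
cycleAdj-sym {suc _} a b (a≢b , inj₂ e) = (λ b≡a → a≢b (sym b≡a)) , inj₁ e

cycleAdj-suc : ∀ {m} (a b : Fin (suc m)) → toℕ a ≡ suc (toℕ b) → cycleAdj (suc m) a b
cycleAdj-suc {m} a b a≡1+b =
  (λ a≡b → 1+n≢n (trans (sym a≡1+b) (cong toℕ a≡b))) , inj₂ (sym b+1%≡a)
  where
  open ≡-Reasoning
  b+1%≡a : (toℕ b + 1) % suc m ≡ toℕ a
  b+1%≡a = begin
    (toℕ b + 1) % suc m ≡⟨ cong (_% suc m) (trans (+-comm (toℕ b) 1) (sym a≡1+b)) ⟩
    toℕ a % suc m       ≡⟨ m<n⇒m%n≡m (toℕ<n a) ⟩
    toℕ a               ∎

cycleAdj-zero-last : ∀ {m} → 1 ≤ m → (a b : Fin (suc m)) →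
  toℕ a ≡ 0 → toℕ b ≡ m → cycleAdj (suc m) a b
cycleAdj-zero-last {suc m-1} _ a b a≡0 b≡m =
  (λ a≡b → 1+n≢0 (trans (sym b≡m) (trans (cong toℕ (sym a≡b)) a≡0))) ,
  inj₂ (trans a≡0 (sym b+1%≡0))
  where
  open ≡-Reasoning
  b+1%≡0 : (toℕ b + 1) % suc (suc m-1) ≡ 0
  b+1%≡0 = begin
    (toℕ b + 1) % suc (suc m-1) ≡⟨ cong (λ t → (t + 1) % suc (suc m-1)) b≡m ⟩
    (suc m-1 + 1) % suc (suc m-1) ≡⟨ cong (_% suc (suc m-1)) (+-comm (suc m-1) 1) ⟩
    suc (suc m-1) % suc (suc m-1) ≡⟨ n%n≡0 (suc (suc m-1)) ⟩
    0 ∎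

module BoxInStrongPower (n k : ℕ) where

  Vertex : Set
  Vertex = Vec (Fin (suc (2 * n))) k

  toVertex : Point k → Vertex
  toVertex = Vec.map (_mod suc (2 * n))

  origin : Vertex
  origin = replicate k zero

  toℕ-lookup-toVertex : ∀ p → InBox n p → ∀ i → toℕ (lookup (toVertex p) i) ≡ lookup p i
  toℕ-lookup-toVertex p p∈B i = begin
    toℕ (lookup (toVertex p) i)       ≡⟨ cong toℕ (lookup-map i _ p) ⟩
    toℕ (lookup p i mod suc (2 * n))  ≡⟨ toℕ-fromℕ< _ ⟩
    lookup p i % suc (2 * n)          ≡⟨ m≤n⇒m%n≡m (proj₂ (p∈B i)) ⟩
    lookup p i                        ∎
    where open ≡-Reasoning

  toℕ-lookup-origin : ∀ i → toℕ (lookup origin i) ≡ 0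
  toℕ-lookup-origin i = cong toℕ (lookup-replicate i zero)

  toVertex-injectiveOnBox : ∀ {p q} → InBox n p → InBox n q → toVertex p ≡ toVertex q → p ≡ q
  toVertex-injectiveOnBox {p} {q} p∈B q∈B eq = lookup-extensionality p q λ i →
    trans (sym (toℕ-lookup-toVertex p p∈B i))
      (trans (cong (λ v → toℕ (lookup v i)) eq) (toℕ-lookup-toVertex q q∈B i))

  origin≢toVertex : Fin k → ∀ {p} → InBox n p → origin ≢ toVertex p
  origin≢toVertex i {p} p∈B eq = <⇒≢ (proj₁ (p∈B i)) (begin
    0                           ≡⟨ toℕ-lookup-origin i ⟨
    toℕ (lookup origin i)       ≡⟨ cong (λ v → toℕ (lookup v i)) eq ⟩
    toℕ (lookup (toVertex p) i) ≡⟨ toℕ-lookup-toVertex p p∈B i ⟩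
    lookup p i                  ∎)
    where open ≡-Reasoning

  CycleAdjacentSomewhere : Vertex → Vertex → Set
  CycleAdjacentSomewhere x y = ∃ λ i → cycleAdj (suc (2 * n)) (lookup x i) (lookup y i)

  ∼⇒cycleAdjacentSomewhere : ∀ p q → InBox n p → InBox n q → p ∼ q →
    toVertex p ≢ toVertex q → CycleAdjacentSomewhere (toVertex p) (toVertex q)
  ∼⇒cycleAdjacentSomewhere _ _ _   _   (inj₁ p≡q) p′≢q′ = ⊥-elim (p′≢q′ (cong toVertex p≡q))
  ∼⇒cycleAdjacentSomewhere p q p∈B q∈B (inj₂ (i , inj₁ pᵢ≡1+qᵢ)) _ =
    i , cycleAdj-suc _ _ (trans (toℕ-lookup-toVertex p p∈B i)
                           (trans pᵢ≡1+qᵢ (cong suc (sym (toℕ-lookup-toVertex q q∈B i)))))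
  ∼⇒cycleAdjacentSomewhere p q p∈B q∈B (inj₂ (i , inj₂ qᵢ≡1+pᵢ)) _ =
    i , cycleAdj-sym _ _ (cycleAdj-suc _ _ (trans (toℕ-lookup-toVertex q q∈B i)
                           (trans qᵢ≡1+pᵢ (cong suc (sym (toℕ-lookup-toVertex p p∈B i))))))

  boundary⇒cycleAdjacentSomewhere : 1 ≤ n → ∀ p → InBoundary n p →
    CycleAdjacentSomewhere origin (toVertex p)
  boundary⇒cycleAdjacentSomewhere _ p (p∈B , i , inj₁ pᵢ≡1) =
    i , cycleAdj-sym _ _ (cycleAdj-suc _ _ (trans (toℕ-lookup-toVertex p p∈B i)
                           (trans pᵢ≡1 (cong suc (sym (toℕ-lookup-origin i))))))
  boundary⇒cycleAdjacentSomewhere n≥1 p (p∈B , i , inj₂ pᵢ≡2n) =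
    i , cycleAdj-zero-last (≤-trans n≥1 (m≤m+n n _)) _ _ (toℕ-lookup-origin i)
          (trans (toℕ-lookup-toVertex p p∈B i) pᵢ≡2n)

  StrongPowerGraph : Graph
  StrongPowerGraph = StrongPower (Complement (Cycle (suc (2 * n)))) k

  cycleAdjacentSomewhere⇒¬adj : ∀ {x y} → CycleAdjacentSomewhere x y → ¬ Adj StrongPowerGraph x y
  cycleAdjacentSomewhere⇒¬adj {x} {y} (i , xᵢ~yᵢ) =
    ¬strongComplementAdj (Cycle (suc (2 * n))) x y i (proj₁ xᵢ~yᵢ) xᵢ~yᵢ

  skeleton⇒independent : 1 ≤ n → Fin k → ∀ {S} → IsSkeleton n k S →
    IsIndependent StrongPowerGraph (origin ∷ List.map toVertex S)
  skeleton⇒independent n≥1 i {S} (unique , _ , boundary , linked) =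
    ( All.tabulate origin≢image
        Unique.∷ unique-map⁺-injectiveOn toVertex-injectiveOnBox inBox unique
    , independent )
    where
    inBox : All (InBox n) S
    inBox = All.map proj₁ boundary

    origin≢image : ∀ {y} → y ∈ List.map toVertex S → origin ≢ y
    origin≢image y∈ with ∈-map⁻ toVertex y∈
    ... | p , p∈S , refl = origin≢toVertex i (All.lookup inBox p∈S)

    independent : ∀ x y → x ∈ origin ∷ List.map toVertex S → y ∈ origin ∷ List.map toVertex S →
      ¬ Adj StrongPowerGraph x y
    independent _ _ (here refl) (here refl) (x≢x , _) = x≢x refl
    independent _ _ (here refl) (there y∈) with ∈-map⁻ toVertex y∈
    ... | q , q∈S , refl = cycleAdjacentSomewhere⇒¬adj
                             (boundary⇒cycleAdjacentSomewhere n≥1 q (All.lookup boundary q∈S))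
    independent _ _ (there x∈) (here refl) with ∈-map⁻ toVertex x∈
    ... | p , p∈S , refl with boundary⇒cycleAdjacentSomewhere n≥1 p (All.lookup boundary p∈S)
    ... | j , o~p = cycleAdjacentSomewhere⇒¬adj (j , cycleAdj-sym _ _ o~p)
    independent _ _ (there x∈) (there y∈) with ∈-map⁻ toVertex x∈ | ∈-map⁻ toVertex y∈
    ... | p , p∈S , refl | q , q∈S , refl = λ adj → cycleAdjacentSomewhere⇒¬adj
      (∼⇒cycleAdjacentSomewhere p q (All.lookup inBox p∈S) (All.lookup inBox q∈S)
         (linked p q p∈S q∈S) (proj₁ adj)) adj

proposition2p2 : (n k : ℕ) → 1 ≤ n → 1 ≤ k → GoodCube n k →
    IndependenceNumber≥ (StrongPower (Complement (Cycle (2 * n + 1))) k) (2 ^ k + 1)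
proposition2p2 n k n≥1 k≥1 (S , skeleton@(_ , |S|≡2^k , _)) =
  subst (λ N → IndependenceNumber≥ (StrongPower (Complement (Cycle N)) k) (2 ^ k + 1))
    (+-comm 1 (2 * n))
    ( origin ∷ List.map toVertex S
    , skeleton⇒independent n≥1 (fromℕ< k≥1) skeleton
    , trans (cong suc (trans (length-map toVertex S) |S|≡2^k)) (+-comm 1 (2 ^ k)))
  where open BoxInStrongPower n k
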